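{- Fix $k\in\mathbb Z_{\ge0}$. Let $(P,Q,R)$ be a $k$-GC triple whose $(1,2)$-entries $(a,b,c)=(p_{12},q_{12},r_{12})$ satisfy $b>\max\{a,c\}$. Then $(P,Q,R)$ has an MM decomposition, and it is unique up to sign: if $(X_1,Y_1,Z_1)$ and $(X_2,Y_2,Z_2)$ are MM decompositions of $(P,Q,R)$, then $(X_1,Y_1,Z_1)=\pm(X_2,Y_2,Z_2)$.
   Context: Fix $k\in\mathbb Z_{\ge0}$. A $k$-GM triple is $(a,b,c)\in\mathbb Z_{\ge1}^3$ with $a^2+b^2+c^2+k(bc+ca+ab)=(3+3k)abc$; a $k$-GM number is an entry of some $k$-GM triple. Let $S=\begin{bmatrix}k&0\\3k^2+3k&k\end{bmatrix}$. A $k$-GC matrix is $P\in SL(2,\mathbb Z)$ whose $(1,2)$-entry $p_{12}$ is a $k$-GM number and $\operatorname{tr}P=(3k+3)p_{12}-k$; a $k$-GC triple is a triple $(P,Q,R)$ of $k$-GC matrices with $Q=PR-S$ and $(p_{12},q_{12},r_{12})$ a $k$-GM triple. An MM decomposition of a $k$-GC triple $(P,Q,R)$ is a triple $(X,Y,Z)$ with $X,Y,Z\in SL(2,\mathbb Z)$, $P=-Z^{ -1}Y^{ -1}$, $Q=-Z^{ -1}X^{ -1}$, $R=-Y^{ -1}X^{ -1}$, and $\operatorname{tr}X=\operatorname{tr}Y=\operatorname{tr}Z$. -}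

module Defs where

open import Data.Nat using (ℕ)
open import Data.Integer using (ℤ; +_; -_; _+_; _-_; _*_; _<_; _>_)
open import Data.Product using (_×_; ∃; ∃-syntax; Σ)
open import Data.Sum using (_⊎_)
open import Relation.Binary.PropositionalEquality using (_≡_)

record Mat : Set where
  constructor mat
  field
    m11 m12 m21 m22 : ℤ
open Mat public

_·_ : Mat → Mat → Mat
A · B = mat (m11 A * m11 B + m12 A * m21 B) (m11 A * m12 B + m12 A * m22 B)
            (m21 A * m11 B + m22 A * m21 B) (m21 A * m12 B + m22 A * m22 B)
infixl 7 _·_

_⊖_ : Mat → Mat → Mat
A ⊖ B = mat (m11 A - m11 B) (m12 A - m12 B) (m21 A - m21 B) (m22 A - m22 B)
infixl 6 _⊖_

neg : Mat → Mat
neg A = mat (- m11 A) (- m12 A) (- m21 A) (- m22 A)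

det : Mat → ℤ
det A = m11 A * m22 A - m12 A * m21 A

tr : Mat → ℤ
tr A = m11 A + m22 A

IsSL2 : Mat → Set
IsSL2 A = det A ≡ + 1

-- inverse of a matrix of determinant 1 (the adjugate)
inv : Mat → Mat
inv A = mat (m22 A) (- m12 A) (- m21 A) (m11 A)

ι : ℕ → ℤ
ι n = + n

IsGMTriple : ℕ → ℤ → ℤ → ℤ → Set
IsGMTriple k a b c =
  (a > + 0) × (b > + 0) × (c > + 0) ×
  (a * a + b * b + c * c + ι k * (b * c + c * a + a * b)
     ≡ (+ 3 + + 3 * ι k) * a * b * c)

IsGMNumber : ℕ → ℤ → Set
IsGMNumber k n =
  ∃[ a ] ∃[ b ] ∃[ c ] (IsGMTriple k a b c × (n ≡ a ⊎ n ≡ b ⊎ n ≡ c))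

Smat : ℕ → Mat
Smat k = mat (ι k) (+ 0) (+ 3 * ι k * ι k + + 3 * ι k) (ι k)

IsGCMatrix : ℕ → Mat → Set
IsGCMatrix k P =
  IsSL2 P × IsGMNumber k (m12 P) ×
  (tr P ≡ (+ 3 * ι k + + 3) * m12 P - ι k)

IsGCTriple : ℕ → Mat → Mat → Mat → Set
IsGCTriple k P Q R =
  IsGCMatrix k P × IsGCMatrix k Q × IsGCMatrix k R ×
  (Q ≡ P · R ⊖ Smat k) ×
  IsGMTriple k (m12 P) (m12 Q) (m12 R)

IsMMDecomp : Mat → Mat → Mat → Mat → Mat → Mat → Set
IsMMDecomp P Q R X Y Z =
  IsSL2 X × IsSL2 Y × IsSL2 Z ×
  (P ≡ neg (inv Z · inv Y)) ×
  (Q ≡ neg (inv Z · inv X)) ×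
  (R ≡ neg (inv Y · inv X)) ×
  (tr X ≡ tr Y) × (tr Y ≡ tr Z)

{-# OPTIONS --safe #-}
-- Given an MM decomposition (X, Y, Z) of (P, Q, R), the middle factor
-- determines the others: X = −(Y R)⁻¹ and Z = −(P Y)⁻¹.  By Cayley–Hamilton
-- Q = −Z⁻¹ X⁻¹ = −P Y² R = P R − (tr Y) P Y R, and since S = k T with
-- T = [[1, 0], [3k + 3, 1]], the equation Q = P R − S becomes
-- (tr Y) Y = k Y₀ for Y₀ = P⁻¹ T R⁻¹.  Conversely, the trace conditions on
-- P, Q and R say exactly that Y₀ and the X and Z it determines have trace k,
-- which gives existence.  Taking determinants, (tr Y)² = k².  For k > 0 every
-- middle factor is thus a non-zero multiple of Y₀; for k = 0 it is traceless
-- and trace-orthogonal to P and R, hence a multiple of the commutator [P, R],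
-- whose (1,2) entry is non-zero because the Markov equation rules out
-- b = 3ac.  Two matrices of determinant 1 that are rational multiples of the
-- same matrix agree up to sign.

module Submission where

open import Defs
open import Data.Nat using (ℕ; zero; suc)
import Data.Nat as ℕ
open import Data.Fin using (Fin; combine; #_)
open import Data.Integer using (ℤ; +_; +0; +[1+_]; -[1+_]; -_; _+_; _-_; _*_; _<_; _>_; 0ℤ; +<+)
open import Data.Integer.Base using (≢-nonZero)
open import Data.Integer.Properties
  using (*-identityˡ; *-identityʳ; *-zeroʳ; *-cancelˡ-≡; i*j≡0⇒i≡0∨j≡0;
         i-j≡0⇒i≡j; i≡j⇒i-j≡0; neg-injective; <⇒≢)
open import Data.Integer.Solver using (module +-*-Solver)
open import Data.Integer.Tactic.RingSolver using (solve)
open import Data.Empty using (⊥-elim)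
open import Data.List using (_∷_; [])
open import Data.Product using (_×_; _,_; ∃-syntax; proj₂)
open import Data.Sum using (_⊎_; inj₁; inj₂; [_,_]′)
open import Data.Vec as Vec using (Vec)
open import Function using (_∘_; id)
open import Relation.Binary.PropositionalEquality
  using (_≡_; _≢_; refl; sym; trans; cong; cong₂; ≢-sym; setoid; module ≡-Reasoning)
import Relation.Binary.Reflection as Reflection

open +-*-Solver using (Polynomial; con; _:+_; _:*_; :-_; _:-_; ⟦_⟧; ⟦_⟧↓; correct)
  renaming (var to polynomial-var)

infixr 6.5 _•_

_•_ : ℤ → Mat → Mat
c • A = mat (c * m11 A) (c * m12 A) (c * m21 A) (c * m22 A)

ν : ℤ → ℤ
ν κ = + 3 * κ + + 3

T : ℤ → Mat
T κ = mat (+ 1) (+ 0) (ν κ) (+ 1)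

⁅_,_⁆ : Mat → Mat → Mat
⁅ A , B ⁆ = A · B ⊖ B · A

E₂₁ : Mat
E₂₁ = mat (+ 0) (+ 0) (+ 1) (+ 0)

TraceCondition : ℤ → Mat → Set
TraceCondition κ A = tr A ≡ ν κ * m12 A - κ

Y₀ : ℤ → Mat → Mat → Mat
Y₀ κ P R = inv P · T κ · inv R

factorX : Mat → Mat → Mat
factorX R Y = inv (neg (Y · R))

factorZ : Mat → Mat → Mat
factorZ P Y = inv (neg (P · Y))

record _∝_ (Y V : Mat) : Set where
  constructor proportional
  field
    c a : ℤ
    c≢0 : c ≢ 0ℤ
    c•Y≡a•V : c • Y ≡ a • V

-- Matrix expressions in n matrix variables, with polynomial entries in the
-- 4n entries of the variables.  Their operations copy those of Defs term for
-- term, so evaluation yields the corresponding Mat terms definitionally, and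
-- Relation.Binary.Reflection turns the normaliser of Algebra.Solver.Ring into
-- a solver for identities between matrices.
record MatExpr (n : ℕ) : Set where
  constructor :mat
  field
    e₁₁ e₁₂ e₂₁ e₂₂ : Polynomial (n ℕ.* 4)
open MatExpr

infixl 7 _:·_
infixl 6 _:⊖_
infixr 6.5 _:•_

_:·_ : ∀ {n} → MatExpr n → MatExpr n → MatExpr n
A :· B = :mat (e₁₁ A :* e₁₁ B :+ e₁₂ A :* e₂₁ B) (e₁₁ A :* e₁₂ B :+ e₁₂ A :* e₂₂ B)
              (e₂₁ A :* e₁₁ B :+ e₂₂ A :* e₂₁ B) (e₂₁ A :* e₁₂ B :+ e₂₂ A :* e₂₂ B)

_:⊖_ : ∀ {n} → MatExpr n → MatExpr n → MatExpr n
A :⊖ B = :mat (e₁₁ A :- e₁₁ B) (e₁₂ A :- e₁₂ B) (e₂₁ A :- e₂₁ B) (e₂₂ A :- e₂₂ B)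

:neg :inv : ∀ {n} → MatExpr n → MatExpr n
:neg A = :mat (:- e₁₁ A) (:- e₁₂ A) (:- e₂₁ A) (:- e₂₂ A)
:inv A = :mat (e₂₂ A) (:- e₁₂ A) (:- e₂₁ A) (e₁₁ A)

:det :tr : ∀ {n} → MatExpr n → Polynomial (n ℕ.* 4)
:det A = e₁₁ A :* e₂₂ A :- e₁₂ A :* e₂₁ A
:tr A = e₁₁ A :+ e₂₂ A

_:•_ : ∀ {n} → Polynomial (n ℕ.* 4) → MatExpr n → MatExpr n
c :• A = :mat (c :* e₁₁ A) (c :* e₁₂ A) (c :* e₂₁ A) (c :* e₂₂ A)

:ν : ∀ {m} → Polynomial m → Polynomial m
:ν κ = con (+ 3) :* κ :+ con (+ 3)

:T : ∀ {n} → Polynomial (n ℕ.* 4) → MatExpr n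
:T κ = :mat (con (+ 1)) (con (+ 0)) (:ν κ) (con (+ 1))

-- A scalar variable of an identity is passed as a matrix variable whose
-- (1,1) entry it is; a scalar identity p = q is stated as ⟪ p ⟫ = ⟪ q ⟫.
⟨_⟩ : ∀ {n} → MatExpr n → Polynomial (n ℕ.* 4)
⟨_⟩ = e₁₁

⟪_⟫ : ∀ {n} → Polynomial (n ℕ.* 4) → MatExpr n
⟪ p ⟫ = :mat p p p p

scalar : ℤ → Mat
scalar x = mat x x x x

private
  mat-cong : ∀ {a b c d a′ b′ c′ d′} → a ≡ a′ → b ≡ b′ → c ≡ c′ → d ≡ d′ →
             mat a b c d ≡ mat a′ b′ c′ d′
  mat-cong refl refl refl refl = refl

  entries : ∀ {n} → Vec Mat n → Vec ℤ (n ℕ.* 4)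
  entries Vec.[] = Vec.[]
  entries (A Vec.∷ ρ) = m11 A Vec.∷ m12 A Vec.∷ m21 A Vec.∷ m22 A Vec.∷ entries ρ

  matrix-var : ∀ {n} → Fin n → MatExpr n
  matrix-var i = :mat (polynomial-var (combine i (# 0))) (polynomial-var (combine i (# 1)))
                      (polynomial-var (combine i (# 2))) (polynomial-var (combine i (# 3)))

  ⟦_⟧ᴹ ⟦_⇓⟧ᴹ : ∀ {n} → MatExpr n → Vec Mat n → Mat
  ⟦ M ⟧ᴹ ρ = mat (⟦ e₁₁ M ⟧ (entries ρ)) (⟦ e₁₂ M ⟧ (entries ρ))
                 (⟦ e₂₁ M ⟧ (entries ρ)) (⟦ e₂₂ M ⟧ (entries ρ))
  ⟦ M ⇓⟧ᴹ ρ = mat (⟦ e₁₁ M ⟧↓ (entries ρ)) (⟦ e₁₂ M ⟧↓ (entries ρ))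
                  (⟦ e₂₁ M ⟧↓ (entries ρ)) (⟦ e₂₂ M ⟧↓ (entries ρ))

  correctᴹ : ∀ {n} (M : MatExpr n) ρ → ⟦ M ⇓⟧ᴹ ρ ≡ ⟦ M ⟧ᴹ ρ
  correctᴹ {n} M ρ =
    mat-cong (correct {n ℕ.* 4} (e₁₁ M) (entries ρ)) (correct {n ℕ.* 4} (e₁₂ M) (entries ρ))
             (correct {n ℕ.* 4} (e₂₁ M) (entries ρ)) (correct {n ℕ.* 4} (e₂₂ M) (entries ρ))

  ⟦_⟧¹¹ ⟦_⇓⟧¹¹ : ∀ {n} → MatExpr n → Vec Mat n → ℤ
  ⟦ M ⟧¹¹ = m11 ∘ ⟦ M ⟧ᴹ
  ⟦ M ⇓⟧¹¹ = m11 ∘ ⟦ M ⇓⟧ᴹ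

  correct¹¹ : ∀ {n} (M : MatExpr n) ρ → ⟦ M ⇓⟧¹¹ ρ ≡ ⟦ M ⟧¹¹ ρ
  correct¹¹ M ρ = cong m11 (correctᴹ M ρ)

module MatrixSolver = Reflection (setoid Mat) matrix-var ⟦_⟧ᴹ ⟦_⇓⟧ᴹ correctᴹ
module ScalarSolver = Reflection (setoid ℤ) matrix-var ⟦_⟧¹¹ ⟦_⇓⟧¹¹ correct¹¹
open MatrixSolver using (_⊜_) renaming (solve to solve-matrix)
open ScalarSolver using () renaming (solve to solve-scalar)

•-identityˡ : ∀ A → + 1 • A ≡ A
•-identityˡ = solve-matrix 1 (λ A → con (+ 1) :• A ⊜ A) refl

•-identityˡ-≡ : ∀ {d} A → d ≡ + 1 → d • A ≡ A
•-identityˡ-≡ A refl = •-identityˡ A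

•-assoc : ∀ x y A → x • y • A ≡ (x * y) • A
•-assoc x y = solve-matrix 3 (λ X Y A →
  ⟨ X ⟩ :• ⟨ Y ⟩ :• A ⊜ (⟨ X ⟩ :* ⟨ Y ⟩) :• A) refl (scalar x) (scalar y)

•-comm : ∀ x y A → x • y • A ≡ y • x • A
•-comm x y = solve-matrix 3 (λ X Y A →
  ⟨ X ⟩ :• ⟨ Y ⟩ :• A ⊜ ⟨ Y ⟩ :• ⟨ X ⟩ :• A) refl (scalar x) (scalar y)

neg-• : ∀ x A → (- x) • A ≡ x • neg A
neg-• x = solve-matrix 2 (λ X A → (:- ⟨ X ⟩) :• A ⊜ ⟨ X ⟩ :• :neg A) refl (scalar x)

det-• : ∀ x A → det (x • A) ≡ x * x * det A
det-• x = solve-scalar 2 (λ X A →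
  ⟪ :det (⟨ X ⟩ :• A) ⟫ ⊜ ⟪ ⟨ X ⟩ :* ⟨ X ⟩ :* :det A ⟫) refl (scalar x)

⊖-involutive : ∀ A B → A ⊖ (A ⊖ B) ≡ B
⊖-involutive = solve-matrix 2 (λ A B → A :⊖ (A :⊖ B) ⊜ B) refl

S≡•T : ∀ κ → mat κ (+ 0) (+ 3 * κ * κ + + 3 * κ) κ ≡ κ • T κ
S≡•T κ = solve-matrix 1 (λ K → let κ = ⟨ K ⟩ in
  :mat κ (con (+ 0)) (con (+ 3) :* κ :* κ :+ con (+ 3) :* κ) κ ⊜ κ :• :T κ) refl (scalar κ)

•-cancelˡ : ∀ {x} A B → x ≢ 0ℤ → x • A ≡ x • B → A ≡ B
•-cancelˡ {x} A B x≢0 eq =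
  mat-cong (cancel (cong m11 eq)) (cancel (cong m12 eq)) (cancel (cong m21 eq)) (cancel (cong m22 eq))
  where
  cancel : ∀ {y z} → x * y ≡ x * z → y ≡ z
  cancel = *-cancelˡ-≡ x _ _ {{≢-nonZero x≢0}}

⊖-cancelˡ : ∀ A {B C} → A ⊖ B ≡ A ⊖ C → B ≡ C
⊖-cancelˡ A {B} {C} eq =
  trans (sym (⊖-involutive A B)) (trans (cong (A ⊖_) eq) (⊖-involutive A C))

det-Y₀ : ∀ κ P R → det (Y₀ κ P R) ≡ det P * det R
det-Y₀ κ = solve-scalar 3 (λ K P R →
  ⟪ :det (:inv P :· :T ⟨ K ⟩ :· :inv R) ⟫ ⊜ ⟪ :det P :* :det R ⟫) refl (scalar κ)

P·Y₀·R : ∀ κ P R → P · Y₀ κ P R · R ≡ (det P * det R) • T κ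
P·Y₀·R κ = solve-matrix 3 (λ K P R →
  P :· (:inv P :· :T ⟨ K ⟩ :· :inv R) :· R ⊜ (:det P :* :det R) :• :T ⟨ K ⟩) refl (scalar κ)

inv-sandwich : ∀ x P Y R → inv P · (x • (P · Y · R)) · inv R ≡ (det P * det R) • x • Y
inv-sandwich x = solve-matrix 4 (λ X P Y R →
  :inv P :· (⟨ X ⟩ :• (P :· Y :· R)) :· :inv R ⊜ (:det P :* :det R) :• ⟨ X ⟩ :• Y) refl (scalar x)

•-sandwich : ∀ x P M R → inv P · (x • M) · inv R ≡ x • (inv P · M · inv R)
•-sandwich x = solve-matrix 4 (λ X P M R →
  :inv P :· (⟨ X ⟩ :• M) :· :inv R ⊜ ⟨ X ⟩ :• (:inv P :· M :· :inv R)) refl (scalar x)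

tr-Y₀ : ∀ κ P R → let Q = P · R ⊖ κ • T κ in
  tr (Y₀ κ P R) ≡ + 2 * κ - (ν κ * m12 Q - tr Q)
tr-Y₀ κ = solve-scalar 3 (λ K P R → let κ = ⟨ K ⟩ ; Q = P :· R :⊖ κ :• :T κ in
  ⟪ :tr (:inv P :· :T κ :· :inv R) ⟫ ⊜ ⟪ con (+ 2) :* κ :- (:ν κ :* e₁₂ Q :- :tr Q) ⟫) refl (scalar κ)

tr-factorX-Y₀ : ∀ κ P R → tr (factorX R (Y₀ κ P R)) ≡ det R * (ν κ * m12 P - tr P)
tr-factorX-Y₀ κ = solve-scalar 3 (λ K P R → let κ = ⟨ K ⟩ in
  ⟪ :tr (:inv (:neg ((:inv P :· :T κ :· :inv R) :· R))) ⟫ ⊜ ⟪ :det R :* (:ν κ :* e₁₂ P :- :tr P) ⟫) refl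
  (scalar κ)

tr-factorZ-Y₀ : ∀ κ P R → tr (factorZ P (Y₀ κ P R)) ≡ det P * (ν κ * m12 R - tr R)
tr-factorZ-Y₀ κ = solve-scalar 3 (λ K P R → let κ = ⟨ K ⟩ in
  ⟪ :tr (:inv (:neg (P :· (:inv P :· :T κ :· :inv R)))) ⟫ ⊜ ⟪ :det P :* (:ν κ :* e₁₂ R :- :tr R) ⟫) refl
  (scalar κ)

det-factorX : ∀ R Y → det (factorX R Y) ≡ det Y * det R
det-factorX = solve-scalar 2 (λ R Y → ⟪ :det (:inv (:neg (Y :· R))) ⟫ ⊜ ⟪ :det Y :* :det R ⟫) refl

det-factorZ : ∀ P Y → det (factorZ P Y) ≡ det P * det Y
det-factorZ = solve-scalar 2 (λ P Y → ⟪ :det (:inv (:neg (P :· Y))) ⟫ ⊜ ⟪ :det P :* :det Y ⟫) refl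

tr-factorX : ∀ R Y → tr (factorX R Y) ≡ - tr (Y · R)
tr-factorX = solve-scalar 2 (λ R Y → ⟪ :tr (:inv (:neg (Y :· R))) ⟫ ⊜ ⟪ :- :tr (Y :· R) ⟫) refl

tr-factorZ : ∀ P Y → tr (factorZ P Y) ≡ - tr (P · Y)
tr-factorZ = solve-scalar 2 (λ P Y → ⟪ :tr (:inv (:neg (P :· Y))) ⟫ ⊜ ⟪ :- :tr (P :· Y) ⟫) refl

factorX-neg : ∀ R Y → factorX R (neg Y) ≡ neg (factorX R Y)
factorX-neg = solve-matrix 2 (λ R Y → :inv (:neg (:neg Y :· R)) ⊜ :neg (:inv (:neg (Y :· R)))) refl

factorZ-neg : ∀ P Y → factorZ P (neg Y) ≡ neg (factorZ P Y)
factorZ-neg = solve-matrix 2 (λ P Y → :inv (:neg (P :· :neg Y)) ⊜ :neg (:inv (:neg (P :· Y)))) refl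

factorX-inverts : ∀ R Y → neg (inv Y · inv (factorX R Y)) ≡ det Y • R
factorX-inverts = solve-matrix 2 (λ R Y →
  :neg (:inv Y :· :inv (:inv (:neg (Y :· R)))) ⊜ :det Y :• R) refl

factorZ-inverts : ∀ P Y → neg (inv (factorZ P Y) · inv Y) ≡ det Y • P
factorZ-inverts = solve-matrix 2 (λ P Y →
  :neg (:inv (:inv (:neg (P :· Y))) :· :inv Y) ⊜ :det Y :• P) refl

factorX-of : ∀ X Y → factorX (neg (inv Y · inv X)) Y ≡ det Y • X
factorX-of = solve-matrix 2 (λ X Y → :inv (:neg (Y :· :neg (:inv Y :· :inv X))) ⊜ :det Y :• X) refl

factorZ-of : ∀ Z Y → factorZ (neg (inv Z · inv Y)) Y ≡ det Y • Z
factorZ-of = solve-matrix 2 (λ Z Y → :inv (:neg (:neg (:inv Z :· :inv Y) :· Y)) ⊜ :det Y :• Z) refl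

-- Cayley–Hamilton Y² = tr Y • Y ⊖ det Y • 1, multiplied by P on the left and R on the right.
factors-product : ∀ P Y R →
  neg (inv (factorZ P Y) · inv (factorX R Y)) ≡ det Y • (P · R) ⊖ tr Y • (P · Y · R)
factors-product = solve-matrix 3 (λ P Y R →
  :neg (:inv (:inv (:neg (P :· Y))) :· :inv (:inv (:neg (Y :· R))))
    ⊜ :det Y :• (P :· R) :⊖ :tr Y :• (P :· Y :· R)) refl

*-identityˡ-≡ : ∀ {d} x → d ≡ + 1 → d * x ≡ x
*-identityˡ-≡ x refl = *-identityˡ x

*-≢0 : ∀ x y → x ≢ 0ℤ → y ≢ 0ℤ → x * y ≢ 0ℤ
*-≢0 x y x≢0 y≢0 = [ x≢0 , y≢0 ]′ ∘ i*j≡0⇒i≡0∨j≡0 x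

i*i≡0⇒i≡0 : ∀ i → i * i ≡ 0ℤ → i ≡ 0ℤ
i*i≡0⇒i≡0 i = [ id , id ]′ ∘ i*j≡0⇒i≡0∨j≡0 i

i*i≡j*j⇒i≡±j : ∀ i j → i * i ≡ j * j → i ≡ j ⊎ i ≡ - j
i*i≡j*j⇒i≡±j i j eq with i*j≡0⇒i≡0∨j≡0 (i - j) (trans difference-of-squares (i≡j⇒i-j≡0 eq))
  where
  difference-of-squares : (i - j) * (i + j) ≡ i * i - j * j
  difference-of-squares = solve (i ∷ j ∷ [])
... | inj₁ i-j≡0 = inj₁ (i-j≡0⇒i≡j i j i-j≡0)
... | inj₂ i+j≡0 = inj₂ (i-j≡0⇒i≡j i (- j) (trans i-[-j]≡i+j i+j≡0))
  where
  i-[-j]≡i+j : i - - j ≡ i + j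
  i-[-j]≡i+j = solve (i ∷ j ∷ [])

i-[i-j]≡j : ∀ {t} i j → t ≡ i - j → i - t ≡ j
i-[i-j]≡j i j refl = solve (i ∷ j ∷ [])

sum-of-positive-squares≢0 : ∀ {a c} → 0ℤ < a → 0ℤ < c → a * a + c * c ≢ 0ℤ
sum-of-positive-squares≢0 {+[1+ m ]} {+[1+ n ]} _ _ ()
sum-of-positive-squares≢0 {+0} (+<+ ())
sum-of-positive-squares≢0 { -[1+ _ ]} ()
sum-of-positive-squares≢0 {+[1+ _ ]} {+0} _ (+<+ ())
sum-of-positive-squares≢0 {+[1+ _ ]} { -[1+ _ ]} _ ()

markov₀-b≢3ac : ∀ {a b c} → IsGMTriple 0 a b c → b ≢ + 3 * a * c
markov₀-b≢3ac {a} {c = c} (a>0 , _ , c>0 , markov) refl =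
  sum-of-positive-squares≢0 a>0 c>0 (trans excess (i≡j⇒i-j≡0 markov))
  where
  excess : let b = + 3 * a * c in
    a * a + c * c ≡ a * a + b * b + c * c + ι 0 * (b * c + c * a + a * b) - (+ 3 + + 3 * ι 0) * a * b * c
  excess = solve (a ∷ c ∷ [])

-- The case k = 0

-- For traceless Y the traces tr (P · Y) and tr (Y · R) are the two coordinates
-- of Y orthogonal to ⁅ P , R ⁆; this is the 2×2 form of y × (u × w) = (y·w) u − (y·u) w.
commutator-identity : ∀ P R y₁ y₂ y₃ → let Y = mat y₁ y₂ y₃ (- y₁) in
  m12 ⁅ P , R ⁆ • Y ≡ m12 Y • ⁅ P , R ⁆ ⊖ (tr (Y · R) • ⁅ P , E₂₁ ⁆ ⊖ tr (P · Y) • ⁅ R , E₂₁ ⁆)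
commutator-identity P R y₁ y₂ y₃ = solve-matrix 5 (λ P R Y₁ Y₂ Y₃ →
  let Y = :mat ⟨ Y₁ ⟩ ⟨ Y₂ ⟩ ⟨ Y₃ ⟩ (:- ⟨ Y₁ ⟩)
      C = P :· R :⊖ R :· P
      E = :mat (con (+ 0)) (con (+ 0)) (con (+ 1)) (con (+ 0))
  in e₁₂ C :• Y
     ⊜ e₁₂ Y :• C :⊖ (:tr (Y :· R) :• (P :· E :⊖ E :· P) :⊖ :tr (P :· Y) :• (R :· E :⊖ E :· R)))
  refl P R (scalar y₁) (scalar y₂) (scalar y₃)

⊖-zero-• : ∀ A B C → A ⊖ (+ 0 • B ⊖ + 0 • C) ≡ A
⊖-zero-• = solve-matrix 3 (λ A B C → A :⊖ (con (+ 0) :• B :⊖ con (+ 0) :• C) ⊜ A) refl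

traceless-form : ∀ Y → tr Y ≡ 0ℤ → Y ≡ mat (m11 Y) (m12 Y) (m21 Y) (- m11 Y)
traceless-form (mat a b c d) a+d≡0 = cong (mat a b c) (begin
  d             ≡⟨ solve (a ∷ d ∷ []) ⟩
  (a + d) - a   ≡⟨ cong (_- a) a+d≡0 ⟩
  0ℤ - a        ≡⟨ solve (a ∷ []) ⟩
  - a           ∎)
  where open ≡-Reasoning

commutator-spans : ∀ P R Y → tr Y ≡ 0ℤ → tr (P · Y) ≡ 0ℤ → tr (Y · R) ≡ 0ℤ →
  m12 ⁅ P , R ⁆ • Y ≡ m12 Y • ⁅ P , R ⁆
commutator-spans P R Y trY≡0 trPY≡0 trYR≡0 = begin
  m12 C • Y
    ≡⟨ cong (m12 C •_) Y≡Y′ ⟩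
  m12 C • Y′
    ≡⟨ commutator-identity P R (m11 Y) (m12 Y) (m21 Y) ⟩
  m12 Y • C ⊖ (tr (Y′ · R) • ⁅ P , E₂₁ ⁆ ⊖ tr (P · Y′) • ⁅ R , E₂₁ ⁆)
    ≡⟨ cong₂ (λ s t → m12 Y • C ⊖ (s • ⁅ P , E₂₁ ⁆ ⊖ t • ⁅ R , E₂₁ ⁆))
             (trans (cong (λ M → tr (M · R)) (sym Y≡Y′)) trYR≡0)
             (trans (cong (λ M → tr (P · M)) (sym Y≡Y′)) trPY≡0) ⟩
  m12 Y • C ⊖ (+ 0 • ⁅ P , E₂₁ ⁆ ⊖ + 0 • ⁅ R , E₂₁ ⁆)
    ≡⟨ ⊖-zero-• (m12 Y • C) ⁅ P , E₂₁ ⁆ ⁅ R , E₂₁ ⁆ ⟩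
  m12 Y • C ∎
  where
  open ≡-Reasoning
  C = ⁅ P , R ⁆
  Y′ = mat (m11 Y) (m12 Y) (m21 Y) (- m11 Y)
  Y≡Y′ = traceless-form Y trY≡0

m12-commutator-identity : ∀ P R → let Q = P · R ⊖ + 0 • T (+ 0) in
  + 2 * m12 R * (m12 Q - + 3 * m12 P * m12 R)
    ≡ m12 R * m12 ⁅ P , R ⁆
      + m12 R * m12 R * (tr P - (ν (+ 0) * m12 P - + 0))
      + m12 P * m12 R * (tr R - (ν (+ 0) * m12 R - + 0))
m12-commutator-identity = solve-scalar 2 (λ P R →
  let Q = P :· R :⊖ con (+ 0) :• :T (con (+ 0))
      a = e₁₂ P
      c = e₁₂ R
  in ⟪ con (+ 2) :* c :* (e₁₂ Q :- con (+ 3) :* a :* c) ⟫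
     ⊜ ⟪ c :* e₁₂ (P :· R :⊖ R :· P)
         :+ c :* c :* (:tr P :- (:ν (con (+ 0)) :* a :- con (+ 0)))
         :+ a :* c :* (:tr R :- (:ν (con (+ 0)) :* c :- con (+ 0))) ⟫) refl

commutator-m12≢0 : ∀ P Q R → Q ≡ P · R ⊖ + 0 • T (+ 0) →
  TraceCondition (+ 0) P → TraceCondition (+ 0) R → IsGMTriple 0 (m12 P) (m12 Q) (m12 R) →
  m12 ⁅ P , R ⁆ ≢ 0ℤ
commutator-m12≢0 P Q R refl trP trR gm@(_ , _ , c>0 , _) m12C≡0 =
  markov₀-b≢3ac gm (i-j≡0⇒i≡j (m12 Q) (+ 3 * m12 P * m12 R)
    ([ ⊥-elim ∘ 2c≢0 , id ]′ (i*j≡0⇒i≡0∨j≡0 (+ 2 * m12 R) 2c[b-3ac]≡0)))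
  where
  open ≡-Reasoning
  2c≢0 : + 2 * m12 R ≢ 0ℤ
  2c≢0 = *-≢0 (+ 2) (m12 R) (λ ()) (≢-sym (<⇒≢ c>0))
  2c[b-3ac]≡0 : + 2 * m12 R * (m12 Q - + 3 * m12 P * m12 R) ≡ 0ℤ
  2c[b-3ac]≡0 = begin
    + 2 * m12 R * (m12 Q - + 3 * m12 P * m12 R)
      ≡⟨ m12-commutator-identity P R ⟩
    m12 R * m12 ⁅ P , R ⁆
      + m12 R * m12 R * (tr P - (ν (+ 0) * m12 P - + 0))
      + m12 P * m12 R * (tr R - (ν (+ 0) * m12 R - + 0))
      ≡⟨ cong₂ _+_ (cong₂ _+_ (cong (m12 R *_) m12C≡0) (cong (m12 R * m12 R *_) (i≡j⇒i-j≡0 trP)))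
                   (cong (m12 P * m12 R *_) (i≡j⇒i-j≡0 trR)) ⟩
    m12 R * 0ℤ + m12 R * m12 R * 0ℤ + m12 P * m12 R * 0ℤ
      ≡⟨ cong₂ _+_ (cong₂ _+_ (*-zeroʳ (m12 R)) (*-zeroʳ (m12 R * m12 R))) (*-zeroʳ (m12 P * m12 R)) ⟩
    0ℤ ∎

-- Proportional matrices of determinant 1

det-of-multiples : ∀ e f Y V → e • Y ≡ f • V → e * e * det Y ≡ f * f * det V
det-of-multiples e f Y V eq = trans (sym (det-• e Y)) (trans (cong det eq) (det-• f V))

det-of-unimodular-multiples : ∀ e f Y V → e • Y ≡ f • V → det Y ≡ + 1 → det V ≡ + 1 → e * e ≡ f * f
det-of-unimodular-multiples e f Y V eq detY detV = begin
  e * e          ≡⟨ *-identityʳ (e * e) ⟨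
  e * e * + 1    ≡⟨ cong (e * e *_) detY ⟨
  e * e * det Y  ≡⟨ det-of-multiples e f Y V eq ⟩
  f * f * det V  ≡⟨ cong (f * f *_) detV ⟩
  f * f * + 1    ≡⟨ *-identityʳ (f * f) ⟩
  f * f          ∎
  where open ≡-Reasoning

unimodular-multiples-≡± : ∀ e f Y W → e ≢ 0ℤ → e • Y ≡ f • W → det Y ≡ + 1 → det W ≡ + 1 →
  Y ≡ W ⊎ Y ≡ neg W
unimodular-multiples-≡± e f Y W e≢0 eq detY detW =
  signs (i*i≡j*j⇒i≡±j f e (sym (det-of-unimodular-multiples e f Y W eq detY detW)))
  where
  signs : f ≡ e ⊎ f ≡ - e → Y ≡ W ⊎ Y ≡ neg W
  signs (inj₁ f≡e) = inj₁ (•-cancelˡ Y W e≢0 (trans eq (cong (_• W) f≡e)))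
  signs (inj₂ f≡-e) = inj₂ (•-cancelˡ Y (neg W) e≢0 (trans eq (trans (cong (_• W) f≡-e) (neg-• e W))))

∝-unimodular-≡± : ∀ {Y W V} → Y ∝ V → W ∝ V → det Y ≡ + 1 → det W ≡ + 1 → Y ≡ W ⊎ Y ≡ neg W
∝-unimodular-≡± {Y} {W} {V} (proportional c a c≢0 cY≡aV) (proportional d b d≢0 dW≡bV) detY detW =
  unimodular-multiples-≡± (b * c) (a * d) Y W (*-≢0 b c b≢0 c≢0) cross detY detW
  where
  open ≡-Reasoning
  b≢0 : b ≢ 0ℤ
  b≢0 refl = d≢0 (i*i≡0⇒i≡0 d (begin
    d * d           ≡⟨ *-identityʳ (d * d) ⟨
    d * d * + 1     ≡⟨ cong (d * d *_) detW ⟨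
    d * d * det W   ≡⟨ det-of-multiples d (+ 0) W V dW≡bV ⟩
    0ℤ              ∎))
  cross : (b * c) • Y ≡ (a * d) • W
  cross = begin
    (b * c) • Y   ≡⟨ •-assoc b c Y ⟨
    b • c • Y     ≡⟨ cong (b •_) cY≡aV ⟩
    b • a • V     ≡⟨ •-comm b a V ⟩
    a • b • V     ≡⟨ cong (a •_) dW≡bV ⟨
    a • d • W     ≡⟨ •-assoc a d W ⟩
    (a * d) • W   ∎

-- MM decompositions

Y₀-decomposition : ∀ κ P Q R → det P ≡ + 1 → det R ≡ + 1 → Q ≡ P · R ⊖ κ • T κ →
  TraceCondition κ P → TraceCondition κ Q → TraceCondition κ R →
  IsMMDecomp P Q R (factorX R (Y₀ κ P R)) (Y₀ κ P R) (factorZ P (Y₀ κ P R))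
Y₀-decomposition κ P Q R detP detR refl trP trQ trR =
  detX , detY , detZ ,
  sym (trans (factorZ-inverts P Y) (•-identityˡ-≡ P detY)) ,
  sym Q≡ ,
  sym (trans (factorX-inverts R Y) (•-identityˡ-≡ R detY)) ,
  trans trX (sym trY) , trans trY (sym trZ)
  where
  open ≡-Reasoning
  Y = Y₀ κ P R
  detPR : det P * det R ≡ + 1
  detPR = cong₂ _*_ detP detR
  detY : det Y ≡ + 1
  detY = trans (det-Y₀ κ P R) detPR
  detX : det (factorX R Y) ≡ + 1
  detX = trans (det-factorX R Y) (cong₂ _*_ detY detR)
  detZ : det (factorZ P Y) ≡ + 1
  detZ = trans (det-factorZ P Y) (cong₂ _*_ detP detY)
  trX : tr (factorX R Y) ≡ κ
  trX = trans (tr-factorX-Y₀ κ P R) (trans (*-identityˡ-≡ _ detR) (i-[i-j]≡j (ν κ * m12 P) κ trP))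
  trZ : tr (factorZ P Y) ≡ κ
  trZ = trans (tr-factorZ-Y₀ κ P R) (trans (*-identityˡ-≡ _ detP) (i-[i-j]≡j (ν κ * m12 R) κ trR))
  trY : tr Y ≡ κ
  trY = begin
    tr Y                           ≡⟨ tr-Y₀ κ P R ⟩
    + 2 * κ - (ν κ * m12 Q - tr Q) ≡⟨ cong (λ t → + 2 * κ - t) (i-[i-j]≡j (ν κ * m12 Q) κ trQ) ⟩
    + 2 * κ - κ                    ≡⟨ solve (κ ∷ []) ⟩
    κ                              ∎
  Q≡ : neg (inv (factorZ P Y) · inv (factorX R Y)) ≡ Q
  Q≡ = begin
    neg (inv (factorZ P Y) · inv (factorX R Y)) ≡⟨ factors-product P Y R ⟩
    det Y • (P · R) ⊖ tr Y • (P · Y · R)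
      ≡⟨ cong₂ _⊖_ (•-identityˡ-≡ (P · R) detY)
                   (cong₂ _•_ trY (trans (P·Y₀·R κ P R) (•-identityˡ-≡ (T κ) detPR))) ⟩
    Q                                           ∎

module MMDecomposition (P Q R X Y Z : Mat) (mm : IsMMDecomp P Q R X Y Z) where

  open ≡-Reasoning

  det-Y : det Y ≡ + 1
  det-Y = let (_ , d , _) = mm in d

  private
    P≡ : P ≡ neg (inv Z · inv Y)
    P≡ = let (_ , _ , _ , e , _) = mm in e
    Q≡ : Q ≡ neg (inv Z · inv X)
    Q≡ = let (_ , _ , _ , _ , e , _) = mm in e
    R≡ : R ≡ neg (inv Y · inv X)
    R≡ = let (_ , _ , _ , _ , _ , e , _) = mm in e
    trX≡trY : tr X ≡ tr Y
    trX≡trY = let (_ , _ , _ , _ , _ , _ , e , _) = mm in e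
    trY≡trZ : tr Y ≡ tr Z
    trY≡trZ = let (_ , _ , _ , _ , _ , _ , _ , e) = mm in e

  X≡factorX : X ≡ factorX R Y
  X≡factorX = sym (begin
    factorX R Y                       ≡⟨ cong (λ R → factorX R Y) R≡ ⟩
    factorX (neg (inv Y · inv X)) Y   ≡⟨ factorX-of X Y ⟩
    det Y • X                         ≡⟨ •-identityˡ-≡ X det-Y ⟩
    X                                 ∎)

  Z≡factorZ : Z ≡ factorZ P Y
  Z≡factorZ = sym (begin
    factorZ P Y                       ≡⟨ cong (λ P → factorZ P Y) P≡ ⟩
    factorZ (neg (inv Z · inv Y)) Y   ≡⟨ factorZ-of Z Y ⟩
    det Y • Z                         ≡⟨ •-identityˡ-≡ Z det-Y ⟩
    Z                                 ∎)

  Q≡factors : Q ≡ P · R ⊖ tr Y • (P · Y · R)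
  Q≡factors = begin
    Q
      ≡⟨ Q≡ ⟩
    neg (inv Z · inv X)
      ≡⟨ cong₂ (λ Z X → neg (inv Z · inv X)) Z≡factorZ X≡factorX ⟩
    neg (inv (factorZ P Y) · inv (factorX R Y))
      ≡⟨ factors-product P Y R ⟩
    det Y • (P · R) ⊖ tr Y • (P · Y · R)
      ≡⟨ cong (_⊖ tr Y • (P · Y · R)) (•-identityˡ-≡ (P · R) det-Y) ⟩
    P · R ⊖ tr Y • (P · Y · R)
      ∎

  module _ (κ : ℤ) (detP : det P ≡ + 1) (detR : det R ≡ + 1) (Q≡PR-κT : Q ≡ P · R ⊖ κ • T κ) where

    middle-factor-equation : tr Y • Y ≡ κ • Y₀ κ P R
    middle-factor-equation = begin
      tr Y • Y                              ≡⟨ •-identityˡ-≡ (tr Y • Y) (cong₂ _*_ detP detR) ⟨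
      (det P * det R) • tr Y • Y            ≡⟨ inv-sandwich (tr Y) P Y R ⟨
      inv P · (tr Y • (P · Y · R)) · inv R  ≡⟨ cong (λ M → inv P · M · inv R) PYR≡κT ⟩
      inv P · (κ • T κ) · inv R             ≡⟨ •-sandwich κ P (T κ) R ⟩
      κ • Y₀ κ P R                          ∎
      where
      PYR≡κT : tr Y • (P · Y · R) ≡ κ • T κ
      PYR≡κT = ⊖-cancelˡ (P · R) (trans (sym Q≡factors) Q≡PR-κT)

    trace-squared : tr Y * tr Y ≡ κ * κ
    trace-squared = det-of-unimodular-multiples (tr Y) κ Y (Y₀ κ P R) middle-factor-equation det-Y
                      (trans (det-Y₀ κ P R) (cong₂ _*_ detP detR))

  traceless-orthogonal : tr Y ≡ 0ℤ → tr (P · Y) ≡ 0ℤ × tr (Y · R) ≡ 0ℤ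
  traceless-orthogonal trY≡0 =
    neg-injective (begin
      - tr (P · Y)      ≡⟨ tr-factorZ P Y ⟨
      tr (factorZ P Y)  ≡⟨ cong tr Z≡factorZ ⟨
      tr Z              ≡⟨ trY≡trZ ⟨
      tr Y              ≡⟨ trY≡0 ⟩
      0ℤ                ∎) ,
    neg-injective (begin
      - tr (Y · R)      ≡⟨ tr-factorX R Y ⟨
      tr (factorX R Y)  ≡⟨ cong tr X≡factorX ⟨
      tr X              ≡⟨ trX≡trY ⟩
      tr Y              ≡⟨ trY≡0 ⟩
      0ℤ                ∎)

Q≡PR⊖kT : ∀ k P Q R → Q ≡ P · R ⊖ Smat k → Q ≡ P · R ⊖ ι k • T (ι k)
Q≡PR⊖kT k P Q R Q≡ = trans Q≡ (cong (P · R ⊖_) (S≡•T (ι k)))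

middle-factors-proportional : ∀ k P Q R → IsGCTriple k P Q R →
  ∃[ V ] (∀ X Y Z → IsMMDecomp P Q R X Y Z → Y ∝ V)
middle-factors-proportional zero P Q R ((detP , _ , trP) , _ , (detR , _ , trR) , Q≡ , gm) =
  ⁅ P , R ⁆ , λ X Y Z mm →
    let open MMDecomposition P Q R X Y Z mm
        trY≡0 = i*i≡0⇒i≡0 (tr Y) (trace-squared (+ 0) detP detR (Q≡PR⊖kT 0 P Q R Q≡))
        (trPY≡0 , trYR≡0) = traceless-orthogonal trY≡0
    in proportional (m12 ⁅ P , R ⁆) (m12 Y) (commutator-m12≢0 P Q R (Q≡PR⊖kT 0 P Q R Q≡) trP trR gm)
                    (commutator-spans P R Y trY≡0 trPY≡0 trYR≡0)
middle-factors-proportional (suc k) P Q R ((detP , _) , _ , (detR , _) , Q≡ , _) =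
  Y₀ κ P R , λ X Y Z mm →
    let open MMDecomposition P Q R X Y Z mm
        Q≡′ = Q≡PR⊖kT (suc k) P Q R Q≡
        trY≢0 : tr Y ≢ 0ℤ
        trY≢0 trY≡0 = κ≢0 (i*i≡0⇒i≡0 κ
          (trans (sym (trace-squared κ detP detR Q≡′)) (cong (λ t → t * t) trY≡0)))
    in proportional (tr Y) κ trY≢0 (middle-factor-equation κ detP detR Q≡′)
  where
  κ = ι (suc k)
  κ≢0 : κ ≢ 0ℤ
  κ≢0 ()

mm-decomposition-exists : ∀ k P Q R → IsGCTriple k P Q R → ∃[ X ] ∃[ Y ] ∃[ Z ] IsMMDecomp P Q R X Y Z
mm-decomposition-exists k P Q R ((detP , _ , trP) , (_ , _ , trQ) , (detR , _ , trR) , Q≡ , _) =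
  factorX R Y , Y , factorZ P Y , Y₀-decomposition (ι k) P Q R detP detR (Q≡PR⊖kT k P Q R Q≡) trP trQ trR
  where
  Y = Y₀ (ι k) P R

mm-decomposition-unique : ∀ k P Q R → IsGCTriple k P Q R → ∀ X₁ Y₁ Z₁ X₂ Y₂ Z₂ →
  IsMMDecomp P Q R X₁ Y₁ Z₁ → IsMMDecomp P Q R X₂ Y₂ Z₂ →
  ((X₁ ≡ X₂) × (Y₁ ≡ Y₂) × (Z₁ ≡ Z₂)) ⊎ ((X₁ ≡ neg X₂) × (Y₁ ≡ neg Y₂) × (Z₁ ≡ neg Z₂))
mm-decomposition-unique k P Q R gc X₁ Y₁ Z₁ X₂ Y₂ Z₂ mm₁ mm₂ =
  signs (∝-unimodular-≡± (Y∝V X₁ Y₁ Z₁ mm₁) (Y∝V X₂ Y₂ Z₂ mm₂) D₁.det-Y D₂.det-Y)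
  where
  module D₁ = MMDecomposition P Q R X₁ Y₁ Z₁ mm₁
  module D₂ = MMDecomposition P Q R X₂ Y₂ Z₂ mm₂
  Y∝V = proj₂ (middle-factors-proportional k P Q R gc)
  signs : Y₁ ≡ Y₂ ⊎ Y₁ ≡ neg Y₂ →
    ((X₁ ≡ X₂) × (Y₁ ≡ Y₂) × (Z₁ ≡ Z₂)) ⊎ ((X₁ ≡ neg X₂) × (Y₁ ≡ neg Y₂) × (Z₁ ≡ neg Z₂))
  signs (inj₁ Y₁≡Y₂) = inj₁
    ( trans D₁.X≡factorX (trans (cong (factorX R) Y₁≡Y₂) (sym D₂.X≡factorX))
    , Y₁≡Y₂
    , trans D₁.Z≡factorZ (trans (cong (factorZ P) Y₁≡Y₂) (sym D₂.Z≡factorZ)))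
  signs (inj₂ Y₁≡-Y₂) = inj₂
    ( trans D₁.X≡factorX
        (trans (cong (factorX R) Y₁≡-Y₂) (trans (factorX-neg R Y₂) (cong neg (sym D₂.X≡factorX))))
    , Y₁≡-Y₂
    , trans D₁.Z≡factorZ
        (trans (cong (factorZ P) Y₁≡-Y₂) (trans (factorZ-neg P Y₂) (cong neg (sym D₂.Z≡factorZ)))))

theorem5p22 : (k : ℕ) (P Q R : Mat) →
    IsGCTriple k P Q R →
    m12 Q > m12 P → m12 Q > m12 R →
    (∃[ X ] ∃[ Y ] ∃[ Z ] IsMMDecomp P Q R X Y Z) ×
    (∀ X₁ Y₁ Z₁ X₂ Y₂ Z₂ →
      IsMMDecomp P Q R X₁ Y₁ Z₁ → IsMMDecomp P Q R X₂ Y₂ Z₂ →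
      ((X₁ ≡ X₂) × (Y₁ ≡ Y₂) × (Z₁ ≡ Z₂)) ⊎
      ((X₁ ≡ neg X₂) × (Y₁ ≡ neg Y₂) × (Z₁ ≡ neg Z₂)))
theorem5p22 k P Q R gc _ _ = mm-decomposition-exists k P Q R gc , mm-decomposition-unique k P Q R gc
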